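{- Let $\alpha$ be a triangular partition having exactly two removable cells and exactly two addable cells. Then the line through the north-east corners of the two removable cells is parallel to the line through the north-east corners of the two addable cells.
   Context: Partitions are identified with their diagrams: cells $(i,j)\in\mathbb{N}^2$ ($i$ column, $j$ row, starting at $0$); the north-east corner of the cell $(i,j)$ is the point $(i+1,j+1)$. For positive reals $r,s$, $\tau_{rs}=\{(i,j)\in\mathbb{N}^2 : \frac{i+1}{r}+\frac{j+1}{s}\le 1\}$; a partition is triangular if it equals $\tau_{rs}$ for some positive reals $r,s$. A cell of a triangular partition $\tau$ is removable if removing it yields a triangular partition; a cell not in $\tau$ is addable if adding it to $\tau$ yields a triangular partition.
   Formalization: The parameters r and s defining $\tau_{rs}$ range over the positive rationals instead of the positive reals. -}

module Defs where

open import Level using (0ℓ)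
open import Data.Nat as ℕ using (ℕ; suc)
open import Data.Integer as ℤ using (ℤ)
open import Data.Rational using (ℚ; 0ℚ; 1ℚ; _<_; _≤_; _+_; _÷_; positive)
import Data.Rational as ℚ
open import Data.Rational.Properties using (pos⇒nonZero)
open import Data.Product using (_×_; _,_; Σ; ∃)
open import Data.Sum using (_⊎_)
open import Relation.Nullary using (¬_)
open import Relation.Binary.PropositionalEquality using (_≡_; _≢_)
open import Function.Bundles using (_⇔_)

-- A cell (i , j): i = column, j = row, both starting at 0.
Cell : Set
Cell = ℕ × ℕ

Diagram : Set₁
Diagram = Cell → Set

toℚ : ℕ → ℚ
toℚ n = ℤ.+ n ℚ./ 1

InTau : (r s : ℚ) → 0ℚ < r → 0ℚ < s → Cell → Set
InTau r s 0<r 0<s (i , j) =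
  ((toℚ (suc i) ÷ r) {{pos⇒nonZero r {{positive 0<r}}}})
    + ((toℚ (suc j) ÷ s) {{pos⇒nonZero s {{positive 0<s}}}}) ≤ 1ℚ

-- A diagram is triangular if it equals (pointwise) τ_{rs} for some r, s > 0.
-- FIDELITY: r, s range over positive rationals instead of positive reals.
Triangular : Diagram → Set
Triangular α =
  Σ ℚ λ r → Σ ℚ λ s → Σ (0ℚ < r) λ 0<r → Σ (0ℚ < s) λ 0<s →
    ∀ c → α c ⇔ InTau r s 0<r 0<s c

remove : Diagram → Cell → Diagram
remove α c d = α d × d ≢ c

add : Diagram → Cell → Diagram
add α c d = α d ⊎ d ≡ c

Removable : Diagram → Cell → Set
Removable α c = α c × Triangular (remove α c)

Addable : Diagram → Cell → Set
Addable α c = ¬ α c × Triangular (add α c)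

ExactlyTwo : (Cell → Set) → Cell → Cell → Set
ExactlyTwo P c₁ c₂ = c₁ ≢ c₂ × P c₁ × P c₂ × (∀ c → P c → c ≡ c₁ ⊎ c ≡ c₂)

neCorner : Cell → ℤ × ℤ
neCorner (i , j) = ℤ.+ (suc i) , ℤ.+ (suc j)

-- The line through p₁, p₂ is parallel to the line through q₁, q₂:
-- the direction vectors p₂ - p₁ and q₂ - q₁ have zero cross product.
Parallel : (ℤ × ℤ) → (ℤ × ℤ) → (ℤ × ℤ) → (ℤ × ℤ) → Set
Parallel (x₁ , y₁) (x₂ , y₂) (u₁ , v₁) (u₂ , v₂) =
  (x₂ ℤ.- x₁) ℤ.* (v₂ ℤ.- v₁) ≡ (y₂ ℤ.- y₁) ℤ.* (u₂ ℤ.- u₁)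

module Submission where

-- A triangular partition is exactly the set of cells whose north-east corner (x, y) satisfies
-- a x + b y ≤ C for some positive integers a, b, C.  Cuts of α, of α ∪ {a₁} and of α ∪ {a₂}
-- combine into a cut of α giving a₁ and a₂ the same level.  For any cut of α, a tie-broken
-- minimal cell outside α is addable, so no cell outside α lies below that level.  Dividing by the
-- gcd yields a primitive (A, B) and a level L with α = {A x + B y < L} and a₁, a₂ on level L.
-- For a removable cell r, Bézout coordinates along that line give a lattice point of level L − 1
-- in the triangle a₁ a₂ r; it lies in α but beyond every cut of α ∖ {r}, so it is r itself.
-- Hence both removable corners lie on level L − 1, parallel to the line through a₁ and a₂.

open import Defs
open import Data.Empty using (⊥-elim)
open import Data.Product using (_×_; _,_; proj₁; proj₂; ∃-syntax; Σ-syntax)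
open import Relation.Binary.PropositionalEquality

-- Lattice points of the plane

module Lattice where

  open import Data.Nat as ℕ using (ℕ; suc)
  import Data.Nat.Properties as ℕ
  open import Data.Nat.Tactic.RingSolver using () renaming (solve-∀ to ℕ-solve-∀)
  open import Data.Integer using (ℤ; ∣_∣; +_; +[1+_]; -[1+_]; _+_; _*_; _-_; -_; 0ℤ; 1ℤ; _≤_; _<_; _/ℕ_; _%ℕ_; +<+)
  import Data.Integer as ℤ
  open import Data.Integer.DivMod using (a≡a%ℕn+[a/ℕn]*n; n%ℕd<d)
  open import Data.Integer.Properties
  open import Data.Integer.Tactic.RingSolver using (solve-∀)
  open import Data.Product using (map; map₂)
  open import Function using (flip)

  infixl 7 _·_

  _·_ : ℤ × ℤ → ℤ × ℤ → ℤ
  (a , b) · (x , y) = a * x + b * y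

  record InHull (P q₁ q₂ q₃ : ℤ × ℤ) : Set where
    constructor in-hull
    field
      half-planes : ∀ n C → C < n · q₁ → C < n · q₂ → C < n · q₃ → C < n · P

  swap-hull : ∀ {P q₁ q₂ q₃} → InHull P q₁ q₂ q₃ → InHull P q₂ q₁ q₃
  swap-hull (in-hull hull) = in-hull λ n C C<₁ C<₂ C<₃ → hull n C C<₂ C<₁ C<₃

  combination-in-hull : ∀ {P q₁ q₂ q₃} (N c₁ c₂ c₃ : ℕ) .{{_ : ℕ.NonZero N}} → N ≡ c₁ ℕ.+ c₂ ℕ.+ c₃ →
                        (∀ n → + N * (n · P) ≡ + c₁ * (n · q₁) + + c₂ * (n · q₂) + + c₃ * (n · q₃)) →
                        InHull P q₁ q₂ q₃
  combination-in-hull {P} {q₁} {q₂} {q₃} N c₁ c₂ c₃ N≡ combine = in-hull separated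
    where
    instance _ = ℤ.positive (+<+ (ℕ.>-nonZero⁻¹ N))
    distribute : ∀ c₁ c₂ c₃ z → (c₁ + c₂ + c₃) * z ≡ c₁ * z + c₂ * z + c₃ * z
    distribute = solve-∀
    separated : ∀ n C → C < n · q₁ → C < n · q₂ → C < n · q₃ → C < n · P
    separated n C C<₁ C<₂ C<₃ = suc[i]≤j⇒i<j (*-cancelˡ-≤-pos (ℤ.suc C) (n · P) (+ N) (begin
      + N * ℤ.suc C                                              ≡⟨ cong (λ m → + m * ℤ.suc C) N≡ ⟩
      (+ c₁ + + c₂ + + c₃) * ℤ.suc C                             ≡⟨ distribute (+ c₁) (+ c₂) (+ c₃) (ℤ.suc C) ⟩
      + c₁ * ℤ.suc C + + c₂ * ℤ.suc C + + c₃ * ℤ.suc C           ≤⟨ +-mono-≤ (+-mono-≤ (above c₁ C<₁) (above c₂ C<₂)) (above c₃ C<₃) ⟩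
      + c₁ * (n · q₁) + + c₂ * (n · q₂) + + c₃ * (n · q₃)        ≡⟨ combine n ⟨
      + N * (n · P)                                              ∎))
      where
      open ≤-Reasoning
      above : ∀ c {z} → C < z → + c * ℤ.suc C ≤ + c * z
      above c C<z = *-monoˡ-≤-nonNeg (+ c) (i<j⇒suc[i]≤j C<z)

  ceiling-division : ∀ u H .{{_ : ℕ.NonZero H}} → ∃[ m ] ∃[ ℓ ] ℓ ℕ.< H × u ≡ m * + H - + ℓ
  ceiling-division u H = - ((- u) /ℕ H) , (- u) %ℕ H , n%ℕd<d (- u) H , (begin
    u                                    ≡⟨ neg-involutive u ⟨
    - - u                                ≡⟨ cong -_ (a≡a%ℕn+[a/ℕn]*n (- u) H) ⟩
    - (+ ℓ + q * + H)                    ≡⟨ negate (+ ℓ) q (+ H) ⟩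
    - q * + H - + ℓ                      ∎)
    where
    open ≡-Reasoning
    ℓ = (- u) %ℕ H
    q = (- u) /ℕ H
    negate : ∀ ℓ q H → - (ℓ + q * H) ≡ - q * H - ℓ
    negate = solve-∀

  negative-gap : ∀ {i j} → i < j → ∃[ h ] i - j ≡ - + suc h
  negative-gap {i} {j} i<j = ∣ j - ℤ.suc i ∣ , (begin
    i - j                            ≡⟨ rearrange i j ⟩
    - (1ℤ + (j - ℤ.suc i))           ≡⟨ cong (λ d → - (1ℤ + d)) (0≤i⇒+∣i∣≡i (i≤j⇒0≤j-i (i<j⇒suc[i]≤j i<j))) ⟨
    - (1ℤ + + ∣ j - ℤ.suc i ∣)       ∎)
    where
    open ≡-Reasoning
    rearrange : ∀ i j → i - j ≡ - (1ℤ + (j - (1ℤ + i)))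
    rearrange = solve-∀

  record Primitive (A B : ℤ) : Set where
    field
      s t : ℤ
      bézout : s * A + t * B ≡ 1ℤ

  module _ {A B : ℤ} (prim : Primitive A B) where
    open Primitive prim

    coordinates : ∀ {x₀ y₀ x y} h → (A , B) · (x , y) ≡ (A , B) · (x₀ , y₀) + h →
                  ∃[ κ ] x ≡ x₀ + h * s + κ * B × y ≡ y₀ + h * t - κ * A
    coordinates {x₀} {y₀} {x} {y} h level = κ , sym along-x , sym along-y
      where
      κ = t * (x - x₀) - s * (y - y₀)
      expand-x : ∀ A B s t x₀ y₀ x y → x₀ + (A * x + B * y - (A * x₀ + B * y₀)) * s + (t * (x - x₀) - s * (y - y₀)) * B
                                      ≡ x + (x - x₀) * (s * A + t * B - 1ℤ)
      expand-x = solve-∀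
      expand-y : ∀ A B s t x₀ y₀ x y → y₀ + (A * x + B * y - (A * x₀ + B * y₀)) * t - (t * (x - x₀) - s * (y - y₀)) * A
                                      ≡ y + (y - y₀) * (s * A + t * B - 1ℤ)
      expand-y = solve-∀
      vanish : ∀ x d → x + d * (1ℤ - 1ℤ) ≡ x
      vanish = solve-∀
      gap : ∀ {a b h} → a ≡ b + h → h ≡ a - b
      gap {a} {b} {h} refl = sym (shift b h)
        where
        shift : ∀ b h → b + h - b ≡ h
        shift = solve-∀
      along-x : x₀ + h * s + κ * B ≡ x
      along-x = trans (cong (λ h → x₀ + h * s + κ * B) (gap level)) (trans (expand-x A B s t x₀ y₀ x y)
        (trans (cong (λ e → x + (x - x₀) * (e - 1ℤ)) bézout) (vanish x (x - x₀))))
      along-y : y₀ + h * t - κ * A ≡ y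
      along-y = trans (cong (λ h → y₀ + h * t - κ * A) (gap level)) (trans (expand-y A B s t x₀ y₀ x y)
        (trans (cong (λ e → y + (y - y₀) * (e - 1ℤ)) bézout) (vanish y (y - y₀))))

    same-level : ∀ {x₀ y₀ x y} → (A , B) · (x₀ , y₀) ≡ (A , B) · (x , y) → ∃[ κ ] x ≡ x₀ + κ * B × y ≡ y₀ - κ * A
    same-level {x₀} {y₀} {x} {y} level = map₂ (λ {κ} → map (flip trans (drop-x x₀ s κ B)) (flip trans (drop-y y₀ t κ A)))
      (coordinates 0ℤ (trans (sym level) (sym (+-identityʳ _))))
      where
      drop-x : ∀ x s κ B → x + 0ℤ * s + κ * B ≡ x + κ * B
      drop-x = solve-∀
      drop-y : ∀ y t κ A → y + 0ℤ * t - κ * A ≡ y - κ * A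
      drop-y = solve-∀

    -- P = p₁ − (s, t) + m (B, −A) with m = ⌈u / (h + 1)⌉ is one level below p₁, and
    -- (k + 1)(h + 1) P = ((k + 1) h − ℓ) p₁ + ℓ p₂ + (k + 1) q, where ℓ = m (h + 1) − u ≤ h.
    lattice-point⁺ : ∀ {x₁ y₁ p₂ q} k h u →
                     p₂ ≡ (x₁ + + suc k * B , y₁ - + suc k * A) →
                     q ≡ (x₁ + - + suc h * s + u * B , y₁ + - + suc h * t - u * A) →
                     ∃[ P ] (A , B) · P + 1ℤ ≡ (A , B) · (x₁ , y₁) × InHull P (x₁ , y₁) p₂ q
    lattice-point⁺ {x₁} {y₁} k h u refl refl with ceiling-division u (suc h)
    ... | m , ℓ , ℓ<H , u≡ with ℕ.m≤n⇒∃[o]m+o≡n (ℕ.s≤s⁻¹ ℓ<H)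
    ...   | d , refl rewrite u≡ = P , on-level ,
      combination-in-hull (suc k ℕ.* suc (ℓ ℕ.+ d)) (k ℕ.* (ℓ ℕ.+ d) ℕ.+ d) ℓ (suc k) (count k ℓ d) combine
      where
      P = (x₁ - s + m * B , y₁ - t - m * A)
      step : ∀ A B s t x₁ y₁ m → A * (x₁ - s + m * B) + B * (y₁ - t - m * A) + 1ℤ ≡ A * x₁ + B * y₁ + (1ℤ - (s * A + t * B))
      step = solve-∀
      on-level : (A , B) · P + 1ℤ ≡ (A , B) · (x₁ , y₁)
      on-level = trans (step A B s t x₁ y₁ m) (trans (cong (λ e → A * x₁ + B * y₁ + (1ℤ - e)) bézout) (+-identityʳ _))
      count : ∀ k ℓ d → suc k ℕ.* suc (ℓ ℕ.+ d) ≡ k ℕ.* (ℓ ℕ.+ d) ℕ.+ d ℕ.+ ℓ ℕ.+ suc k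
      count = ℕ-solve-∀
      identity : ∀ a b x₁ y₁ s t A B m K L D →
        (1ℤ + K) * (1ℤ + (L + D)) * (a * (x₁ - s + m * B) + b * (y₁ - t - m * A))
        ≡ (K * (L + D) + D) * (a * x₁ + b * y₁)
          + L * (a * (x₁ + (1ℤ + K) * B) + b * (y₁ - (1ℤ + K) * A))
          + (1ℤ + K) * (a * (x₁ + - (1ℤ + (L + D)) * s + (m * (1ℤ + (L + D)) - L) * B)
                      + b * (y₁ + - (1ℤ + (L + D)) * t - (m * (1ℤ + (L + D)) - L) * A))
      identity = solve-∀
      combine : ∀ n → + (suc k ℕ.* suc (ℓ ℕ.+ d)) * (n · P)
                      ≡ + (k ℕ.* (ℓ ℕ.+ d) ℕ.+ d) * (n · (x₁ , y₁))
                        + + ℓ * (n · (x₁ + + suc k * B , y₁ - + suc k * A))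
                        + + suc k * (n · (x₁ + - + suc (ℓ ℕ.+ d) * s + (m * + suc (ℓ ℕ.+ d) - + ℓ) * B ,
                                          y₁ + - + suc (ℓ ℕ.+ d) * t - (m * + suc (ℓ ℕ.+ d) - + ℓ) * A))
      combine (a , b) = trans (cong (_* ((a , b) · P)) (pos-* (suc k) (suc (ℓ ℕ.+ d))))
        (trans (identity a b x₁ y₁ s t A B m (+ k) (+ ℓ) (+ d))
               (cong (λ c → c * v₁ + + ℓ * v₂ + + suc k * v₃) (sym c₁-lift)))
        where
        v₁ = (a , b) · (x₁ , y₁)
        v₂ = (a , b) · (x₁ + + suc k * B , y₁ - + suc k * A)
        v₃ = (a , b) · (x₁ + - + suc (ℓ ℕ.+ d) * s + (m * + suc (ℓ ℕ.+ d) - + ℓ) * B ,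
                        y₁ + - + suc (ℓ ℕ.+ d) * t - (m * + suc (ℓ ℕ.+ d) - + ℓ) * A)
        c₁-lift : + (k ℕ.* (ℓ ℕ.+ d) ℕ.+ d) ≡ + k * (+ ℓ + + d) + + d
        c₁-lift = trans (pos-+ (k ℕ.* (ℓ ℕ.+ d)) d) (cong (_+ + d) (pos-* k (ℓ ℕ.+ d)))

    lattice-point-in-coordinates :
      ∀ {x₁ y₁ x₂ y₂ x y} → (A , B) · (x₁ , y₁) ≡ (A , B) · (x₂ , y₂) → (x₁ , y₁) ≢ (x₂ , y₂) →
      ∀ κ → x₂ ≡ x₁ + κ * B → y₂ ≡ y₁ - κ * A →
      ∀ h u → x ≡ x₁ + - + suc h * s + u * B → y ≡ y₁ + - + suc h * t - u * A →
      ∃[ P ] (A , B) · P + 1ℤ ≡ (A , B) · (x₁ , y₁) × InHull P (x₁ , y₁) (x₂ , y₂) (x , y)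
    lattice-point-in-coordinates {x₁} {y₁} _ p₁≢p₂ (+ 0) x₂≡ y₂≡ _ _ _ _ =
      ⊥-elim (p₁≢p₂ (cong₂ _,_ (sym (trans x₂≡ (+-identityʳ x₁))) (sym (trans y₂≡ (+-identityʳ y₁)))))
    lattice-point-in-coordinates _ _ +[1+ k ] x₂≡ y₂≡ h u x≡ y≡ =
      lattice-point⁺ k h u (cong₂ _,_ x₂≡ y₂≡) (cong₂ _,_ x≡ y≡)
    lattice-point-in-coordinates {x₁} {y₁} {x₂} {y₂} {x} {y} level₁₂ _ -[1+ k ] x₂≡ y₂≡ h u x≡ y≡ =
      map₂ (map (flip trans (sym level₁₂)) swap-hull) (lattice-point⁺ {x₂} {y₂} k h (u + K) p₁≡ q≡)
      where
      K = + suc k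
      H = - + suc h
      back-x : ∀ x k B → x ≡ x + - k * B + k * B
      back-x = solve-∀
      back-y : ∀ y k A → y ≡ y - - k * A - k * A
      back-y = solve-∀
      shift-x : ∀ x H s u k B → x + H * s + u * B ≡ x + - k * B + H * s + (u + k) * B
      shift-x = solve-∀
      shift-y : ∀ y H t u k A → y + H * t - u * A ≡ y - - k * A + H * t - (u + k) * A
      shift-y = solve-∀
      p₁≡ : (x₁ , y₁) ≡ (x₂ + K * B , y₂ - K * A)
      p₁≡ = cong₂ _,_ (trans (back-x x₁ K B) (cong (_+ K * B) (sym x₂≡)))
                      (trans (back-y y₁ K A) (cong (_- K * A) (sym y₂≡)))
      q≡ : (x , y) ≡ (x₂ + H * s + (u + K) * B , y₂ + H * t - (u + K) * A)
      q≡ = cong₂ _,_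
        (trans x≡ (trans (shift-x x₁ H s u K B) (cong (λ x₂ → x₂ + H * s + (u + K) * B) (sym x₂≡))))
        (trans y≡ (trans (shift-y y₁ H t u K A) (cong (λ y₂ → y₂ + H * t - (u + K) * A) (sym y₂≡))))

    lattice-point : ∀ {p₁ p₂ q} → (A , B) · p₁ ≡ (A , B) · p₂ → p₁ ≢ p₂ → (A , B) · q < (A , B) · p₁ →
                    ∃[ P ] (A , B) · P + 1ℤ ≡ (A , B) · p₁ × InHull P p₁ p₂ q
    lattice-point {x₁ , y₁} {x₂ , y₂} {x , y} level₁₂ p₁≢p₂ q<p₁ =
      lattice-point-in-coordinates level₁₂ p₁≢p₂ (proj₁ line) (proj₁ (proj₂ line)) (proj₂ (proj₂ line))
        (proj₁ depth) (proj₁ below) (proj₁ (proj₂ below)) (proj₂ (proj₂ below))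
      where
      regain : ∀ a b → a ≡ b + (a - b)
      regain = solve-∀
      line = same-level {x₁} {y₁} {x₂} {y₂} level₁₂
      depth = negative-gap q<p₁
      below = coordinates {x₁} {y₁} {x} {y} (- + suc (proj₁ depth))
        (trans (regain ((A , B) · (x , y)) ((A , B) · (x₁ , y₁))) (cong (λ g → (A , B) · (x₁ , y₁) + g) (proj₂ depth)))

    level-lines-parallel : ∀ {p₁ p₂ q₁ q₂} → (A , B) · p₁ ≡ (A , B) · p₂ → (A , B) · q₁ ≡ (A , B) · q₂ →
                           Parallel p₁ p₂ q₁ q₂
    level-lines-parallel {x₁ , y₁} {x₂ , y₂} {u₁ , v₁} {u₂ , v₂} p-level q-level = begin
      (x₂ - x₁) * (v₂ - v₁)                              ≡⟨ cong₂ (λ x v → (x - x₁) * (v - v₁)) x₂≡ v₂≡ ⟩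
      (x₁ + κ * B - x₁) * (v₁ - λ′ * A - v₁)             ≡⟨ cross x₁ y₁ u₁ v₁ κ λ′ A B ⟩
      (y₁ - κ * A - y₁) * (u₁ + λ′ * B - u₁)             ≡⟨ cong₂ (λ y u → (y - y₁) * (u - u₁)) y₂≡ u₂≡ ⟨
      (y₂ - y₁) * (u₂ - u₁)                              ∎
      where
      open ≡-Reasoning
      p-line = same-level {x₁} {y₁} {x₂} {y₂} p-level
      q-line = same-level {u₁} {v₁} {u₂} {v₂} q-level
      κ = proj₁ p-line
      x₂≡ = proj₁ (proj₂ p-line)
      y₂≡ = proj₂ (proj₂ p-line)
      λ′ = proj₁ q-line
      u₂≡ = proj₁ (proj₂ q-line)
      v₂≡ = proj₂ (proj₂ q-line)
      cross : ∀ x₁ y₁ u₁ v₁ κ λ′ A B → (x₁ + κ * B - x₁) * (v₁ - λ′ * A - v₁) ≡ (y₁ - κ * A - y₁) * (u₁ + λ′ * B - u₁)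
      cross = solve-∀

open Lattice

open import Data.Nat as ℕ using (ℕ; suc; _+_; _*_; _≤_; _<_; NonZero; z≤n; s≤s)
import Data.Nat.Properties as ℕ
open import Data.Nat.Coprimality using (Coprime; coprime-/gcd; coprime-Bézout)
open import Data.Nat.DivMod using (_%_; _/_; %-remove-+ʳ; m<n⇒m%n≡m; m*[n/m]≡n)
open import Data.Nat.Divisibility using (m∣m*n)
open import Data.Nat.GCD using (gcd; gcd[m,n]≢0; gcd[m,n]∣m; gcd[m,n]∣n; module Bézout)
open import Data.Nat.Induction using (<-wellFounded)
open import Data.Nat.Tactic.RingSolver using (solve-∀)
open import Data.Integer as ℤ using (+_; +[1+_]; -[1+_]; 0ℤ; 1ℤ)
import Data.Integer.Properties as ℤ
open import Data.Integer.GCD using () renaming (gcd to gcdℤ)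
import Data.Integer.Tactic.RingSolver as ℤ-Ring
open import Data.Rational as ℚ using (ℚ; mkℚ; 0ℚ; _÷_; toℚᵘ)
import Data.Rational.Properties as ℚ
open import Data.Rational.Unnormalised as ℚᵘ using (mkℚᵘ; *≡*; *≤*) renaming (_≃_ to _≃ᵘ_)
import Data.Rational.Unnormalised.Properties as ℚᵘ
import Data.Product.Properties as ×
open import Data.Sum using (_⊎_; inj₁; inj₂; [_,_]′)
open import Function using (_∘_)
open import Function.Bundles using (_⇔_; mk⇔; Equivalence)
import Function.Properties.Equivalence as ⇔
open import Induction.WellFounded using (Acc; acc)
open import Relation.Nullary using (¬_; Dec; yes; no; _×-dec_)
open import Relation.Nullary.Decidable using (_⊎-dec_)
import Relation.Nullary.Decidable as Dec
open import Relation.Unary using (Decidable)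

-- Triangular partitions as cuts

neX neY : Cell → ℕ
neX (i , _) = suc i
neY (_ , j) = suc j

weight : ℕ → ℕ → Cell → ℕ
weight a b c = a * neX c + b * neY c

record Cut (α : Diagram) : Set where
  field
    a b bound : ℕ
    .{{a-nonZero}} : NonZero a
    .{{b-nonZero}} : NonZero b
    spec : ∀ c → α c ⇔ weight a b c ≤ bound

  level : Cell → ℕ
  level = weight a b

  inside : ∀ {c} → α c → level c ≤ bound
  inside {c} = Equivalence.to (spec c)

  outside : ∀ {c} → ¬ α c → bound < level c
  outside {c} c∉α = ℕ.≰⇒> (c∉α ∘ Equivalence.from (spec c))

  decidable : Decidable α
  decidable c = Dec.map (⇔.sym (spec c)) (level c ℕ.≤? bound)

data PositiveFraction : ℚ → Set where
  fraction : ∀ p q .(c : Coprime (suc p) (suc q)) → PositiveFraction (mkℚ +[1+ p ] q c)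

positive-fraction : ∀ {r} → 0ℚ ℚ.< r → PositiveFraction r
positive-fraction {mkℚ +[1+ p ] q _} _ = fraction p q _
positive-fraction {mkℚ (+ 0) _ _} (ℚ.*<* (ℤ.+<+ ()))
positive-fraction {mkℚ -[1+ _ ] _ _} (ℚ.*<* ())

numerator : ℚ → ℕ
numerator r = ℤ.∣ ℚ.↥ r ∣

numerator-nonZero : ∀ {r} → 0ℚ ℚ.< r → NonZero (numerator r)
numerator-nonZero 0<r with positive-fraction 0<r
... | fraction _ _ _ = _

÷-fraction : ∀ n p q .(c : Coprime (suc p) (suc q)) →
             toℚᵘ (toℚ n ÷ mkℚ +[1+ p ] q c) ≃ᵘ mkℚᵘ (+ (n * suc q)) p
÷-fraction n p q c = ℚᵘ.≃-trans (ℚ.toℚᵘ-homo-* (toℚ n) _)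
  (ℚᵘ.≃-trans (ℚᵘ.*-congʳ (ℚ.toℚᵘ-fromℚᵘ (mkℚᵘ (+ n) 0))) (*≡* cross))
  where
  cross : (+ n ℤ.* +[1+ q ]) ℤ.* + suc p ≡ + (n * suc q) ℤ.* + suc (p + 0)
  cross = cong₂ (λ m k → m ℤ.* + suc k) (sym (ℤ.pos-* n (suc q))) (sym (ℕ.+-identityʳ p))

inTau⇔ : ∀ r s (0<r : 0ℚ ℚ.< r) (0<s : 0ℚ ℚ.< s) c →
         InTau r s 0<r 0<s c ⇔ weight (ℚ.↧ₙ r * numerator s) (ℚ.↧ₙ s * numerator r) c ≤ numerator r * numerator s
inTau⇔ r s 0<r 0<s (i , j) with positive-fraction 0<r | positive-fraction 0<s
... | fraction p q c | fraction p′ q′ c′ = mk⇔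
  (λ τ → lower (ℚᵘ.≤-respˡ-≃ sum≃ (ℚ.toℚᵘ-mono-≤ τ)))
  (λ w → ℚ.toℚᵘ-cancel-≤ (ℚᵘ.≤-respˡ-≃ (ℚᵘ.≃-sym sum≃) (*≤* (subst₂ ℤ._≤_ (sym lhs) (sym rhs) (ℤ.+≤+ w)))))
  where
  X = suc i * suc q
  Y = suc j * suc q′
  sum≃ : toℚᵘ ((toℚ (suc i) ÷ mkℚ +[1+ p ] q c) ℚ.+ (toℚ (suc j) ÷ mkℚ +[1+ p′ ] q′ c′))
         ≃ᵘ mkℚᵘ (+ X) p ℚᵘ.+ mkℚᵘ (+ Y) p′
  sum≃ = ℚᵘ.≃-trans (ℚ.toℚᵘ-homo-+ (toℚ (suc i) ÷ mkℚ +[1+ p ] q c) (toℚ (suc j) ÷ mkℚ +[1+ p′ ] q′ c′))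
                    (ℚᵘ.+-cong (÷-fraction (suc i) p q c) (÷-fraction (suc j) p′ q′ c′))
  reorder : ∀ i j q q′ p p′ → i * q * p′ + j * q′ * p ≡ q * p′ * i + q′ * p * j
  reorder = solve-∀
  lhs : (+ X ℤ.* + suc p′ ℤ.+ + Y ℤ.* + suc p) ℤ.* + 1 ≡ + weight (suc q * suc p′) (suc q′ * suc p) (i , j)
  lhs = begin
    (+ X ℤ.* + suc p′ ℤ.+ + Y ℤ.* + suc p) ℤ.* + 1  ≡⟨ ℤ.*-identityʳ _ ⟩
    + X ℤ.* + suc p′ ℤ.+ + Y ℤ.* + suc p           ≡⟨ cong₂ ℤ._+_ (ℤ.pos-* X (suc p′)) (ℤ.pos-* Y (suc p)) ⟨
    + (X * suc p′) ℤ.+ + (Y * suc p)                ≡⟨ ℤ.pos-+ (X * suc p′) (Y * suc p) ⟨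
    + (X * suc p′ + Y * suc p)                      ≡⟨ cong +_ (reorder (suc i) (suc j) (suc q) (suc q′) (suc p) (suc p′)) ⟩
    + weight (suc q * suc p′) (suc q′ * suc p) (i , j) ∎
    where open ≡-Reasoning
  rhs : + 1 ℤ.* + (suc p * suc p′) ≡ + (suc p * suc p′)
  rhs = ℤ.*-identityˡ _
  lower : mkℚᵘ (+ X) p ℚᵘ.+ mkℚᵘ (+ Y) p′ ℚᵘ.≤ ℚᵘ.1ℚᵘ → weight (suc q * suc p′) (suc q′ * suc p) (i , j) ≤ suc p * suc p′
  lower (*≤* le) = ℤ.drop‿+≤+ (subst₂ ℤ._≤_ lhs rhs le)

triangular⇒cut : ∀ {α} → Triangular α → Cut α
triangular⇒cut (r , s , 0<r , 0<s , α⇔τ) = record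
  { a = ℚ.↧ₙ r * numerator s
  ; b = ℚ.↧ₙ s * numerator r
  ; bound = numerator r * numerator s
  ; a-nonZero = ℕ.m*n≢0 (ℚ.↧ₙ r) (numerator s)
  ; b-nonZero = ℕ.m*n≢0 (ℚ.↧ₙ s) (numerator r)
  ; spec = λ c → ⇔.trans (α⇔τ c) (inTau⇔ r s 0<r 0<s c)
  }
  where instance
    _ = numerator-nonZero 0<r
    _ = numerator-nonZero 0<s

*-cancelˡ-≤-⇔ : ∀ k {m n} .{{_ : NonZero k}} → k * m ≤ k * n ⇔ m ≤ n
*-cancelˡ-≤-⇔ k = mk⇔ (ℕ.*-cancelˡ-≤ k) (ℕ.*-monoʳ-≤ k)

weight-rescale : ∀ {a b C u v a′ b′} .{{_ : NonZero C}} .{{_ : NonZero u}} .{{_ : NonZero v}} →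
                 u * a ≡ C * a′ → v * b ≡ C * b′ →
                 ∀ c → weight (a′ * v) (b′ * u) c ≤ u * v ⇔ weight a b c ≤ C
weight-rescale {a} {b} {C} {u} {v} {a′} {b′} ua≡Ca′ vb≡Cb′ c =
  ⇔.trans (⇔.sym (*-cancelˡ-≤-⇔ C))
    (⇔.trans (subst₂ (λ m n → (C * weight (a′ * v) (b′ * u) c ≤ C * (u * v)) ⇔ (m ≤ n))
                     scaled (ℕ.*-comm C (u * v)) ⇔.refl)
      (*-cancelˡ-≤-⇔ (u * v)))
  where
  instance _ = ℕ.m*n≢0 u v
  regroup : ∀ C a′ b′ u v x y → C * (a′ * v * x + b′ * u * y) ≡ C * a′ * (v * x) + C * b′ * (u * y)
  regroup = solve-∀
  collect : ∀ a b u v x y → u * a * (v * x) + v * b * (u * y) ≡ u * v * (a * x + b * y)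
  collect = solve-∀
  scaled : C * weight (a′ * v) (b′ * u) c ≡ u * v * weight a b c
  scaled = begin
    C * weight (a′ * v) (b′ * u) c                ≡⟨ regroup C a′ b′ u v (neX c) (neY c) ⟩
    C * a′ * (v * neX c) + C * b′ * (u * neY c)   ≡⟨ cong₂ (λ m n → m * (v * neX c) + n * (u * neY c)) ua≡Ca′ vb≡Cb′ ⟨
    u * a * (v * neX c) + v * b * (u * neY c)     ≡⟨ collect a b u v (neX c) (neY c) ⟩
    u * v * weight a b c                          ∎
    where open ≡-Reasoning

numerator-/ : ∀ C a .{{_ : NonZero a}} → numerator (+ C ℚ./ a) * a ≡ C * ℚ.↧ₙ (+ C ℚ./ a)
numerator-/ C a = begin
  numerator r * a            ≡⟨ ℤ.abs-* (ℚ.↥ r) (+ a) ⟨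
  ℤ.∣ ℚ.↥ r ℤ.* + a ∣         ≡⟨ cong ℤ.∣_∣ cross ⟩
  ℤ.∣ + C ℤ.* ℚ.↧ r ∣         ≡⟨ ℤ.abs-* (+ C) (ℚ.↧ r) ⟩
  C * ℚ.↧ₙ r                 ∎
  where
  open ≡-Reasoning
  r = + C ℚ./ a
  g = gcdℤ (+ C) (+ a)
  cross : ℚ.↥ r ℤ.* + a ≡ + C ℤ.* ℚ.↧ r
  cross = begin
    ℚ.↥ r ℤ.* + a               ≡⟨ cong (ℚ.↥ r ℤ.*_) (ℚ.↧-/ (+ C) a) ⟨
    ℚ.↥ r ℤ.* (ℚ.↧ r ℤ.* g)     ≡⟨ exchange (ℚ.↥ r) (ℚ.↧ r) g ⟩
    ℚ.↧ r ℤ.* (ℚ.↥ r ℤ.* g)     ≡⟨ cong (ℚ.↧ r ℤ.*_) (ℚ.↥-/ (+ C) a) ⟩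
    ℚ.↧ r ℤ.* + C               ≡⟨ ℤ.*-comm (ℚ.↧ r) (+ C) ⟩
    + C ℤ.* ℚ.↧ r               ∎
    where
    exchange : ∀ x y z → x ℤ.* (y ℤ.* z) ≡ y ℤ.* (x ℤ.* z)
    exchange = ℤ-Ring.solve-∀

cut⇒triangular : ∀ {α} (h : Cut α) → .{{NonZero (Cut.bound h)}} → Triangular α
cut⇒triangular {α} h = r , s , 0<r , 0<s , λ c →
  ⇔.trans (spec c) (⇔.sym (⇔.trans (inTau⇔ r s 0<r 0<s c)
    (weight-rescale {u = numerator r} {numerator s} {ℚ.↧ₙ r} {ℚ.↧ₙ s} (numerator-/ bound a) (numerator-/ bound b) c)))
  where
  open Cut h
  r = + bound ℚ./ a
  s = + bound ℚ./ b
  0<r : 0ℚ ℚ.< r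
  0<r = ℚ.positive⁻¹ r {{ℚ.normalize-pos bound a}}
  0<s : 0ℚ ℚ.< s
  0<s = ℚ.positive⁻¹ s {{ℚ.normalize-pos bound b}}
  instance
    _ = numerator-nonZero 0<r
    _ = numerator-nonZero 0<s

-- The line through the addable cells

_≟ᶜ_ : (c d : Cell) → Dec (c ≡ d)
_≟ᶜ_ = ×.≡-dec ℕ._≟_ ℕ._≟_

corner-injective : ∀ {c d} → neX c ≡ neX d → neY c ≡ neY d → c ≡ d
corner-injective {_ , _} {_ , _} refl refl = refl

neX≤weight : ∀ a b c .{{_ : NonZero a}} → neX c ≤ weight a b c
neX≤weight a b c = ℕ.≤-trans (ℕ.m≤n*m (neX c) a) (ℕ.m≤m+n (a * neX c) (b * neY c))

neY≤weight : ∀ a b c .{{_ : NonZero b}} → neY c ≤ weight a b c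
neY≤weight a b c = ℕ.≤-trans (ℕ.m≤n*m (neY c) b) (ℕ.m≤n+m (b * neY c) (a * neX c))

weight-nonZero : ∀ a b c .{{_ : NonZero a}} → NonZero (weight a b c)
weight-nonZero a b c = ℕ.>-nonZero (ℕ.<-≤-trans ℕ.z<s (neX≤weight a b c))

weight-combination : ∀ l m a₁ b₁ a₂ b₂ c →
                     weight (l * a₁ + m * a₂) (l * b₁ + m * b₂) c ≡ l * weight a₁ b₁ c + m * weight a₂ b₂ c
weight-combination l m a₁ b₁ a₂ b₂ c = distribute l m a₁ b₁ a₂ b₂ (neX c) (neY c)
  where
  distribute : ∀ l m a₁ b₁ a₂ b₂ x y →
               (l * a₁ + m * a₂) * x + (l * b₁ + m * b₂) * y ≡ l * (a₁ * x + b₁ * y) + m * (a₂ * x + b₂ * y)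
  distribute = solve-∀

nonZero-+ : ∀ m n .{{_ : NonZero m}} → NonZero (m + n)
nonZero-+ (suc _) _ = _

cut-by-separation : ∀ {α} a b C .{{_ : NonZero a}} .{{_ : NonZero b}} → Decidable α →
                    (∀ {c} → α c → weight a b c ≤ C) → (∀ {c} → ¬ α c → C < weight a b c) → Cut α
cut-by-separation {α} a b C α? inside outside = record { a = a ; b = b ; bound = C ; spec = λ c → mk⇔ inside (from c) }
  where
  from : ∀ c → weight a b c ≤ C → α c
  from c w≤C with α? c
  ... | yes c∈α = c∈α
  ... | no c∉α = ⊥-elim (ℕ.<⇒≱ (outside c∉α) w≤C)

add-decidable : ∀ {α} → Decidable α → ∀ a → Decidable (add α a)
add-decidable α? a c = α? c ⊎-dec (c ≟ᶜ a)

TouchingCut : Diagram → Cell → Set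
TouchingCut α a = Σ[ h ∈ Cut (add α a) ] Cut.level h a ≡ Cut.bound h

-- q k + p n, where p is the slack of a below k's bound and q > 0 its excess over n's bound.
touching-cut : ∀ {α a} → Cut α → Cut (add α a) → ¬ α a → TouchingCut α a
touching-cut {α} {a} n k a∉α = cut-by-separation A B C (add-decidable (Cut.decidable n) a) inside outside , touches
  where
  module n = Cut n
  module k = Cut k
  k-slack = ℕ.m≤n⇒∃[o]m+o≡n (k.inside (inj₂ refl))
  n-excess = ℕ.m≤n⇒∃[o]m+o≡n (n.outside a∉α)
  p = proj₁ k-slack
  q₀ = proj₁ n-excess
  q = suc q₀
  A = q * k.a + p * n.a
  B = q * k.b + p * n.b
  C = q * k.bound + p * n.bound
  instance
    _ = nonZero-+ (q * k.a) (p * n.a) {{ℕ.m*n≢0 q k.a}}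
    _ = nonZero-+ (q * k.b) (p * n.b) {{ℕ.m*n≢0 q k.b}}
  level : ∀ c → weight A B c ≡ q * k.level c + p * n.level c
  level = weight-combination q p k.a k.b n.a n.b
  touches : weight A B a ≡ C
  touches = begin
    weight A B a                                    ≡⟨ level a ⟩
    q * k.level a + p * n.level a                   ≡⟨ cong (λ x → q * k.level a + p * x) (proj₂ n-excess) ⟨
    q * k.level a + p * (suc n.bound + q₀)          ≡⟨ exchange q₀ p (k.level a) n.bound ⟩
    q * (k.level a + p) + p * n.bound               ≡⟨ cong (λ x → q * x + p * n.bound) (proj₂ k-slack) ⟩
    C                                               ∎
    where
    open ≡-Reasoning
    exchange : ∀ q₀ p w C → suc q₀ * w + p * (suc C + q₀) ≡ suc q₀ * (w + p) + p * C
    exchange = solve-∀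
  inside : ∀ {c} → add α a c → weight A B c ≤ C
  inside (inj₁ c∈α) = ℕ.≤-trans (ℕ.≤-reflexive (level _))
    (ℕ.+-mono-≤ (ℕ.*-monoʳ-≤ q (k.inside (inj₁ c∈α))) (ℕ.*-monoʳ-≤ p (n.inside c∈α)))
  inside (inj₂ refl) = ℕ.≤-reflexive touches
  outside : ∀ {c} → ¬ add α a c → C < weight A B c
  outside {c} c∉ = ℕ.<-≤-trans
    (ℕ.+-mono-<-≤ (ℕ.*-monoʳ-< q (k.outside c∉)) (ℕ.*-monoʳ-≤ p (ℕ.<⇒≤ (n.outside (c∉ ∘ inj₁)))))
    (ℕ.≤-reflexive (sym (level c)))

touching-cut-outside : ∀ {α a} (t : TouchingCut α a) {c} → ¬ α c → Cut.bound (proj₁ t) ≤ Cut.level (proj₁ t) c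
touching-cut-outside {a = a} (h , touches) {c} c∉α with c ≟ᶜ a
... | yes refl = ℕ.≤-reflexive (sym touches)
... | no c≢a = ℕ.<⇒≤ (Cut.outside h [ c∉α , c≢a ]′)

-- l h₁ + m h₂, where l is the excess of a₁ over h₂ and m that of a₂ over h₁: both reach C + l m.
balanced-cut : ∀ {α a₁ a₂} → Decidable α → TouchingCut α a₁ → TouchingCut α a₂ → ¬ α a₁ → ¬ α a₂ → a₁ ≢ a₂ →
               Σ[ h ∈ Cut α ] Cut.level h a₁ ≡ Cut.level h a₂
balanced-cut {α} {a₁} {a₂} α? t₁@(h₁ , touches₁) t₂@(h₂ , touches₂) a₁∉α a₂∉α a₁≢a₂ =
  cut-by-separation A B C α? inside outside , balance
  where
  module h₁ = Cut h₁
  module h₂ = Cut h₂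
  excess₁ = ℕ.m≤n⇒∃[o]m+o≡n (h₂.outside [ a₁∉α , a₁≢a₂ ]′)
  excess₂ = ℕ.m≤n⇒∃[o]m+o≡n (h₁.outside [ a₂∉α , a₁≢a₂ ∘ sym ]′)
  l₀ = proj₁ excess₁
  m₀ = proj₁ excess₂
  l = suc l₀
  m = suc m₀
  A = l * h₁.a + m * h₂.a
  B = l * h₁.b + m * h₂.b
  C = l * h₁.bound + m * h₂.bound
  instance
    _ = nonZero-+ (l * h₁.a) (m * h₂.a) {{ℕ.m*n≢0 l h₁.a}}
    _ = nonZero-+ (l * h₁.b) (m * h₂.b) {{ℕ.m*n≢0 l h₁.b}}
  level : ∀ c → weight A B c ≡ l * h₁.level c + m * h₂.level c
  level = weight-combination l m h₁.a h₁.b h₂.a h₂.b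
  inside : ∀ {c} → α c → weight A B c ≤ C
  inside {c} c∈α = ℕ.≤-trans (ℕ.≤-reflexive (level c))
    (ℕ.+-mono-≤ (ℕ.*-monoʳ-≤ l (h₁.inside (inj₁ c∈α))) (ℕ.*-monoʳ-≤ m (h₂.inside (inj₁ c∈α))))
  outside : ∀ {c} → ¬ α c → C < weight A B c
  outside {c} c∉α = ℕ.<-≤-trans (strict (c ≟ᶜ a₁)) (ℕ.≤-reflexive (sym (level c)))
    where
    strict : Dec (c ≡ a₁) → C < l * h₁.level c + m * h₂.level c
    strict (yes refl) = ℕ.+-mono-≤-< (ℕ.*-monoʳ-≤ l (touching-cut-outside t₁ c∉α)) (ℕ.*-monoʳ-< m (h₂.outside [ c∉α , a₁≢a₂ ]′))
    strict (no c≢a₁) = ℕ.+-mono-<-≤ (ℕ.*-monoʳ-< l (h₁.outside [ c∉α , c≢a₁ ]′)) (ℕ.*-monoʳ-≤ m (touching-cut-outside t₂ c∉α))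
  balance : weight A B a₁ ≡ weight A B a₂
  balance = begin
    weight A B a₁                                ≡⟨ level a₁ ⟩
    l * h₁.level a₁ + m * h₂.level a₁            ≡⟨ cong₂ (λ x y → l * x + m * y) (sym touches₁) (proj₂ excess₁) ⟨
    l * h₁.bound + m * (suc h₂.bound + l₀)       ≡⟨ symmetric l₀ m₀ h₁.bound h₂.bound ⟩
    l * (suc h₁.bound + m₀) + m * h₂.bound       ≡⟨ cong₂ (λ x y → l * x + m * y) (proj₂ excess₂) (sym touches₂) ⟩
    l * h₁.level a₂ + m * h₂.level a₂            ≡⟨ level a₂ ⟨
    weight A B a₂                                ∎
    where
    open ≡-Reasoning
    symmetric : ∀ l₀ m₀ C₁ C₂ → suc l₀ * C₁ + suc m₀ * (suc C₂ + l₀) ≡ suc l₀ * (suc C₁ + m₀) + suc m₀ * C₂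
    symmetric = solve-∀

minimum : ∀ {A : Set} {P : A → Set} (f : A → ℕ) → (∀ n → Dec (∃[ x ] P x × f x < n)) →
          ∀ {u} → P u → ∃[ v ] P v × (∀ {x} → P x → f v ≤ f x)
minimum {P = P} f below? {u} Pu = descend u Pu (<-wellFounded (f u))
  where
  descend : ∀ u → P u → Acc _<_ (f u) → ∃[ v ] P v × (∀ {x} → P x → f v ≤ f x)
  descend u Pu (acc smaller) with below? (f u)
  ... | yes (x , Px , fx<fu) = descend x Px (smaller fx<fu)
  ... | no ∄below = u , Pu , λ Px → ℕ.≮⇒≥ (λ fx<fu → ∄below (_ , Px , fx<fu))

exists-below? : ∀ {P : Cell → Set} → Decidable P → ∀ a b .{{_ : NonZero a}} .{{_ : NonZero b}} n →
         Dec (∃[ c ] P c × weight a b c < n)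
exists-below? {P} P? a b n = Dec.map′ (λ (i , _ , j , _ , found) → (i , j) , found) bounded
  (ℕ.anyUpTo? (λ i → ℕ.anyUpTo? (λ j → P? (i , j) ×-dec (weight a b (i , j) ℕ.<? n)) n) n)
  where
  bounded : ∃[ c ] P c × weight a b c < n →
            ∃[ i ] i < n × ∃[ j ] j < n × P (i , j) × weight a b (i , j) < n
  bounded ((i , j) , found@(_ , w<n)) =
    i , ℕ.<-trans (ℕ.n<1+n i) (ℕ.≤-<-trans (neX≤weight a b (i , j)) w<n) ,
    j , ℕ.<-trans (ℕ.n<1+n j) (ℕ.≤-<-trans (neY≤weight a b (i , j)) w<n) , found

remainder-unique : ∀ S {m n k l} .{{_ : NonZero S}} → m + S * k ≡ n + S * l → m < S → n < S → m ≡ n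
remainder-unique S {m} {n} {k} {l} eq m<S n<S = begin
  m                  ≡⟨ m<n⇒m%n≡m m<S ⟨
  m % S              ≡⟨ %-remove-+ʳ m (m∣m*n k) ⟨
  (m + S * k) % S    ≡⟨ cong (_% S) eq ⟩
  (n + S * l) % S    ≡⟨ %-remove-+ʳ n (m∣m*n l) ⟩
  n % S              ≡⟨ m<n⇒m%n≡m n<S ⟩
  n                  ∎
  where open ≡-Reasoning

perturbed-injective : ∀ S a b .{{_ : NonZero S}} .{{_ : NonZero b}} {c d} →
                      neX c + S * weight a b c ≡ neX d + S * weight a b d → neX c < S → neX d < S → c ≡ d
perturbed-injective S a b {c} {d} eq xc<S xd<S = corner-injective x≡ y≡
  where
  x≡ : neX c ≡ neX d
  x≡ = remainder-unique S eq xc<S xd<S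
  w≡ : weight a b c ≡ weight a b d
  w≡ = ℕ.*-cancelˡ-≡ _ _ S (ℕ.+-cancelˡ-≡ (neX c) _ _ (trans eq (cong (_+ S * weight a b d) (sym x≡))))
  y≡ : neY c ≡ neY d
  y≡ = ℕ.*-cancelˡ-≡ _ _ b (ℕ.+-cancelˡ-≡ (a * neX c) _ _ (trans w≡ (cong (λ x → a * x + b * neY d) (sym x≡))))

-- The cell outside α minimising S · level + neX, with S beyond the level of u, is unique,
-- so adding it to α is cut out by that perturbed weight.
addable-below : ∀ {α} (h : Cut α) {u} → ¬ α u → ∃[ v ] Addable α v × Cut.level h v ≤ Cut.level h u
addable-below {α} h {u} u∉α = v , (v∉α , cut⇒triangular h′ {{weight-nonZero a′ b′ v}}) , ℕ.s≤s⁻¹ (small (v-min u∉α))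
  where
  open Cut h
  S = suc (level u)
  a′ = suc (S * a)
  b′ = S * b
  instance _ = ℕ.m*n≢0 S b
  W = weight a′ b′
  perturbed : ∀ c → W c ≡ neX c + S * level c
  perturbed c = expand S a b (neX c) (neY c)
    where
    expand : ∀ S a b x y → suc (S * a) * x + S * b * y ≡ x + S * (a * x + b * y)
    expand = solve-∀
  minimal = minimum W (exists-below? (Dec.¬? ∘ decidable) a′ b′) u∉α
  v = proj₁ minimal
  v∉α = proj₁ (proj₂ minimal)
  v-min = proj₂ (proj₂ minimal)
  small : ∀ {c} → W c ≤ W u → level c < S
  small {c} Wc≤Wu = ℕ.*-cancelˡ-< S (level c) S (begin-strict
    S * level c          ≤⟨ ℕ.m≤n+m (S * level c) (neX c) ⟩
    neX c + S * level c  ≡⟨ perturbed c ⟨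
    W c                  ≤⟨ Wc≤Wu ⟩
    W u                  ≡⟨ perturbed u ⟩
    neX u + S * level u  <⟨ ℕ.+-monoˡ-< (S * level u) (ℕ.s≤s (neX≤weight a b u)) ⟩
    S + S * level u      ≡⟨ ℕ.*-suc S (level u) ⟨
    S * S                ∎)
    where open ℕ.≤-Reasoning
  neX<S : ∀ {c} → W c ≤ W u → neX c < S
  neX<S {c} Wc≤Wu = ℕ.≤-<-trans (neX≤weight a b c) (small Wc≤Wu)
  inside′ : ∀ {c} → add α v c → W c ≤ W v
  inside′ {c} (inj₁ c∈α) = ℕ.<⇒≤ (begin-strict
    W c                  ≡⟨ perturbed c ⟩
    neX c + S * level c  <⟨ ℕ.+-monoˡ-< (S * level c) neX<S′ ⟩
    S + S * level c      ≡⟨ ℕ.*-suc S (level c) ⟨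
    S * suc (level c)    ≤⟨ ℕ.*-monoʳ-≤ S (ℕ.≤-<-trans (inside c∈α) (outside v∉α)) ⟩
    S * level v          ≤⟨ ℕ.m≤n+m (S * level v) (neX v) ⟩
    neX v + S * level v  ≡⟨ perturbed v ⟨
    W v                  ∎)
    where
    open ℕ.≤-Reasoning
    neX<S′ : neX c < S
    neX<S′ = ℕ.m<n⇒m<1+n (ℕ.≤-<-trans (neX≤weight a b c) (ℕ.≤-<-trans (inside c∈α) (outside u∉α)))
  inside′ (inj₂ refl) = ℕ.≤-refl
  outside′ : ∀ {c} → ¬ add α v c → W v < W c
  outside′ {c} c∉ = ℕ.≤∧≢⇒< Wv≤Wc λ Wv≡Wc → c∉ (inj₂ (sym (distinct Wv≡Wc)))
    where
    Wv≤Wc = v-min (c∉ ∘ inj₁)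
    distinct : W v ≡ W c → v ≡ c
    distinct Wv≡Wc = perturbed-injective S a b
      (trans (sym (perturbed v)) (trans Wv≡Wc (perturbed c)))
      (neX<S (v-min u∉α)) (neX<S (subst (_≤ W u) Wv≡Wc (v-min u∉α)))
  h′ : Cut (add α v)
  h′ = cut-by-separation a′ b′ (W v) (add-decidable decidable v) inside′ outside′

strictly-below : ∀ {α a₁ a₂} (h : Cut α) → Cut.level h a₁ ≡ Cut.level h a₂ → ¬ α a₁ →
                 (∀ c → Addable α c → c ≡ a₁ ⊎ c ≡ a₂) → ∀ c → α c ⇔ Cut.level h c < Cut.level h a₁
strictly-below {α} {a₁} {a₂} h balance a₁∉α addable-only c = mk⇔ (λ c∈α → ℕ.≤-<-trans (inside c∈α) (outside a₁∉α)) from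
  where
  open Cut h
  from : level c < level a₁ → α c
  from c<a₁ with decidable c
  ... | yes c∈α = c∈α
  ... | no c∉α = ⊥-elim (ℕ.<⇒≱ c<a₁ (ℕ.≤-trans (on-line (addable-only v v-addable)) v≤c))
    where
    found = addable-below h c∉α
    v = proj₁ found
    v-addable = proj₁ (proj₂ found)
    v≤c : level v ≤ level c
    v≤c = proj₂ (proj₂ found)
    on-line : ∀ {v} → v ≡ a₁ ⊎ v ≡ a₂ → level a₁ ≤ level v
    on-line (inj₁ refl) = ℕ.≤-refl
    on-line (inj₂ refl) = ℕ.≤-reflexive balance

weight-scale : ∀ g A B c → weight (g * A) (g * B) c ≡ g * weight A B c
weight-scale g A B c = factor g A B (neX c) (neY c)
  where
  factor : ∀ g A B x y → g * A * x + g * B * y ≡ g * (A * x + B * y)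
  factor = solve-∀

lift-successor : ∀ x A y B → 1 + y * B ≡ x * A → 1ℤ ℤ.+ + y ℤ.* + B ≡ + x ℤ.* + A
lift-successor x A y B eq = trans (cong (λ w → 1ℤ ℤ.+ w) (sym (ℤ.pos-* y B))) (trans (cong +_ eq) (ℤ.pos-* x A))

bézout⇒primitive : ∀ {A B} → Bézout.Identity 1 A B → Primitive (+ A) (+ B)
bézout⇒primitive {A} {B} (Bézout.+- x y 1+yB≡xA) = record { s = + x ; t = ℤ.- + y ; bézout = begin
  + x ℤ.* + A ℤ.+ ℤ.- + y ℤ.* + B        ≡⟨ cong (ℤ._+ ℤ.- + y ℤ.* + B) (lift-successor x A y B 1+yB≡xA) ⟨
  (1ℤ ℤ.+ + y ℤ.* + B) ℤ.+ ℤ.- + y ℤ.* + B ≡⟨ cancel (+ y) (+ B) ⟩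
  1ℤ                                      ∎ }
  where
  open ≡-Reasoning
  cancel : ∀ y B → (1ℤ ℤ.+ y ℤ.* B) ℤ.+ ℤ.- y ℤ.* B ≡ 1ℤ
  cancel = ℤ-Ring.solve-∀
bézout⇒primitive {A} {B} (Bézout.-+ x y 1+xA≡yB) = record { s = ℤ.- + x ; t = + y ; bézout = begin
  ℤ.- + x ℤ.* + A ℤ.+ + y ℤ.* + B            ≡⟨ cong (λ w → ℤ.- + x ℤ.* + A ℤ.+ w) (lift-successor y B x A 1+xA≡yB) ⟨
  ℤ.- + x ℤ.* + A ℤ.+ (1ℤ ℤ.+ + x ℤ.* + A)   ≡⟨ cancel (+ x) (+ A) ⟩
  1ℤ                                          ∎ }
  where
  open ≡-Reasoning
  cancel : ∀ x A → ℤ.- x ℤ.* A ℤ.+ (1ℤ ℤ.+ x ℤ.* A) ≡ 1ℤ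
  cancel = ℤ-Ring.solve-∀

*-cancelˡ-<-⇔ : ∀ k {m n} .{{_ : NonZero k}} → k * m < k * n ⇔ m < n
*-cancelˡ-<-⇔ k = mk⇔ (ℕ.*-cancelˡ-< k _ _) (ℕ.*-monoʳ-< k)

record AddableLine (α : Diagram) (a₁ a₂ : Cell) : Set where
  field
    A B : ℕ
    prim : Primitive (+ A) (+ B)
    below : ∀ c → α c ⇔ weight A B c < weight A B a₁
    on-line : weight A B a₁ ≡ weight A B a₂

primitive-line : ∀ {α a₁ a₂} (h : Cut α) → Cut.level h a₁ ≡ Cut.level h a₂ →
                 (∀ c → α c ⇔ Cut.level h c < Cut.level h a₁) → AddableLine α a₁ a₂
primitive-line {α} {a₁} {a₂} h balance below = record
  { A = A ; B = B ; prim = bézout⇒primitive (coprime-Bézout (coprime-/gcd a b))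
  ; below = λ c → ⇔.trans (below c)
      (⇔.trans (subst₂ (λ m n → (level c < level a₁) ⇔ (m < n)) (scale c) (scale a₁) ⇔.refl) (*-cancelˡ-<-⇔ g))
  ; on-line = ℕ.*-cancelˡ-≡ _ _ g (trans (sym (scale a₁)) (trans balance (scale a₂)))
  }
  where
  open Cut h
  g = gcd a b
  instance _ = ℕ.≢-nonZero (gcd[m,n]≢0 a b (inj₁ (ℕ.≢-nonZero⁻¹ a)))
  A = a / g
  B = b / g
  scale : ∀ c → level c ≡ g * weight A B c
  scale c = trans (cong₂ (λ a′ b′ → weight a′ b′ c) (sym (m*[n/m]≡n (gcd[m,n]∣m a b))) (sym (m*[n/m]≡n (gcd[m,n]∣n a b))))
                  (weight-scale g A B c)

addable-line : ∀ {α a₁ a₂} → Triangular α → Addable α a₁ → Addable α a₂ → a₁ ≢ a₂ →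
               (∀ c → Addable α c → c ≡ a₁ ⊎ c ≡ a₂) → AddableLine α a₁ a₂
addable-line tri (a₁∉α , tri₁) (a₂∉α , tri₂) a₁≢a₂ addable-only =
  primitive-line h balance (strictly-below h balance a₁∉α addable-only)
  where
  n = triangular⇒cut tri
  balanced = balanced-cut (Cut.decidable n) (touching-cut n (triangular⇒cut tri₁) a₁∉α)
                          (touching-cut n (triangular⇒cut tri₂) a₂∉α) a₁∉α a₂∉α a₁≢a₂
  h = proj₁ balanced
  balance = proj₂ balanced

-- The removable cells

weight-corner : ∀ A B c → + weight A B c ≡ (+ A , + B) · neCorner c
weight-corner A B (i , j) = trans (ℤ.pos-+ (A * suc i) (B * suc j)) (cong₂ ℤ._+_ (ℤ.pos-* A (suc i)) (ℤ.pos-* B (suc j)))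

level-corner : ∀ {A B c d} → weight A B c ≡ weight A B d → (+ A , + B) · neCorner c ≡ (+ A , + B) · neCorner d
level-corner {A} {B} {c} {d} eq = trans (sym (weight-corner A B c)) (trans (cong +_ eq) (weight-corner A B d))

neCorner-injective : ∀ {c d} → neCorner c ≡ neCorner d → c ≡ d
neCorner-injective {_ , _} {_ , _} refl = refl

positive-coordinate : ∀ {x} → 0ℤ ℤ.< x → ∃[ i ] + suc i ≡ x
positive-coordinate {+[1+ i ]} _ = i , refl
positive-coordinate {+ 0} (ℤ.+<+ ())
positive-coordinate { -[1+ _ ]} ()

corner-in-hull : ∀ {P c₁ c₂ c₃} → InHull P (neCorner c₁) (neCorner c₂) (neCorner c₃) → ∃[ c ] neCorner c ≡ P
corner-in-hull {x , y} {c₁} {c₂} {c₃} (in-hull hull) = (proj₁ i , proj₁ j) , cong₂ _,_ (proj₂ i) (proj₂ j)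
  where
  first : ∀ x y → 1ℤ ℤ.* x ℤ.+ 0ℤ ℤ.* y ≡ x
  first = ℤ-Ring.solve-∀
  second : ∀ x y → 0ℤ ℤ.* x ℤ.+ 1ℤ ℤ.* y ≡ y
  second = ℤ-Ring.solve-∀
  first-positive : ∀ c → 0ℤ ℤ.< (1ℤ , 0ℤ) · neCorner c
  first-positive (_ , _) = ℤ.+<+ (s≤s z≤n)
  second-positive : ∀ c → 0ℤ ℤ.< (0ℤ , 1ℤ) · neCorner c
  second-positive (_ , _) = ℤ.+<+ (s≤s z≤n)
  i = positive-coordinate (subst (0ℤ ℤ.<_) (first x y)
        (hull (1ℤ , 0ℤ) 0ℤ (first-positive c₁) (first-positive c₂) (first-positive c₃)))
  j = positive-coordinate (subst (0ℤ ℤ.<_) (second x y)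
        (hull (0ℤ , 1ℤ) 0ℤ (second-positive c₁) (second-positive c₂) (second-positive c₃)))

module _ {α a₁ a₂} (L : AddableLine α a₁ a₂) (a₁≢a₂ : a₁ ≢ a₂) where
  open AddableLine L

  removable-is-only-corner : ∀ {r} → Removable α r → ∀ c → suc (weight A B c) ≡ weight A B a₁ →
                             InHull (neCorner c) (neCorner a₁) (neCorner a₂) (neCorner r) → c ≡ r
  removable-is-only-corner {r} (_ , tri) c c-level (in-hull hull) with c ≟ᶜ r
  ... | yes c≡r = c≡r
  ... | no c≢r = ⊥-elim (ℕ.<⇒≱ c-beyond (h′.inside (c∈α , c≢r)))
    where
    module h′ = Cut (triangular⇒cut tri)
    c∈α : α c
    c∈α = Equivalence.from (below c) (ℕ.≤-reflexive c-level)
    a∉α : ∀ {a} → weight A B a₁ ≤ weight A B a → ¬ α a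
    a∉α {a} a₁≤a a∈α = ℕ.<⇒≱ (Equivalence.to (below a) a∈α) a₁≤a
    beyond : ∀ {d} → ¬ remove α r d → + h′.bound ℤ.< (+ h′.a , + h′.b) · neCorner d
    beyond {d} d∉ = subst (+ h′.bound ℤ.<_) (weight-corner h′.a h′.b d) (ℤ.+<+ (h′.outside d∉))
    c-beyond : h′.bound < h′.level c
    c-beyond = ℤ.drop‿+<+ (subst (+ h′.bound ℤ.<_) (sym (weight-corner h′.a h′.b c))
      (hull (+ h′.a , + h′.b) (+ h′.bound)
        (beyond (a∉α ℕ.≤-refl ∘ proj₁))
        (beyond (a∉α (ℕ.≤-reflexive on-line) ∘ proj₁))
        (beyond (λ r∈ → proj₂ r∈ refl))))

  removable-level : ∀ {r} → Removable α r → suc (weight A B r) ≡ weight A B a₁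
  removable-level {r} removable@(r∈α , _) =
    subst (λ d → suc (weight A B d) ≡ weight A B a₁) (removable-is-only-corner removable c c-level c-hull) c-level
    where
    r-below : (+ A , + B) · neCorner r ℤ.< (+ A , + B) · neCorner a₁
    r-below = subst₂ ℤ._<_ (weight-corner A B r) (weight-corner A B a₁) (ℤ.+<+ (Equivalence.to (below r) r∈α))
    found = lattice-point prim {neCorner a₁} {neCorner a₂} {neCorner r}
              (level-corner {A} {B} {a₁} {a₂} on-line) (a₁≢a₂ ∘ neCorner-injective) r-below
    corner = corner-in-hull {proj₁ found} {a₁} {a₂} {r} (proj₂ (proj₂ found))
    c = proj₁ corner
    c-hull : InHull (neCorner c) (neCorner a₁) (neCorner a₂) (neCorner r)
    c-hull = subst (λ P → InHull P (neCorner a₁) (neCorner a₂) (neCorner r)) (sym (proj₂ corner)) (proj₂ (proj₂ found))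
    c-level : suc (weight A B c) ≡ weight A B a₁
    c-level = trans (ℕ.+-comm 1 (weight A B c)) (ℤ.+-injective (begin
      + weight A B c ℤ.+ 1ℤ                ≡⟨ cong (ℤ._+ 1ℤ) (weight-corner A B c) ⟩
      (+ A , + B) · neCorner c ℤ.+ 1ℤ      ≡⟨ cong (λ P → (+ A , + B) · P ℤ.+ 1ℤ) (proj₂ corner) ⟩
      (+ A , + B) · proj₁ found ℤ.+ 1ℤ     ≡⟨ proj₁ (proj₂ found) ⟩
      (+ A , + B) · neCorner a₁            ≡⟨ weight-corner A B a₁ ⟨
      + weight A B a₁                      ∎))
      where open ≡-Reasoning

  removables-parallel : ∀ {r₁ r₂} → Removable α r₁ → Removable α r₂ →
                        Parallel (neCorner r₁) (neCorner r₂) (neCorner a₁) (neCorner a₂)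
  removables-parallel {r₁} {r₂} removable₁ removable₂ =
    level-lines-parallel prim {neCorner r₁} {neCorner r₂} {neCorner a₁} {neCorner a₂}
      (level-corner {A} {B} {r₁} {r₂} (ℕ.suc-injective (trans (removable-level removable₁) (sym (removable-level removable₂)))))
      (level-corner {A} {B} {a₁} {a₂} on-line)

mainTheorem11 : (α : Diagram) → Triangular α →
    (r₁ r₂ a₁ a₂ : Cell) →
    ExactlyTwo (Removable α) r₁ r₂ →
    ExactlyTwo (Addable α) a₁ a₂ →
    Parallel (neCorner r₁) (neCorner r₂) (neCorner a₁) (neCorner a₂)
mainTheorem11 α tri r₁ r₂ a₁ a₂ (_ , removable₁ , removable₂ , _) (a₁≢a₂ , addable₁ , addable₂ , addable-only) =
  removables-parallel (addable-line tri addable₁ addable₂ a₁≢a₂ addable-only) a₁≢a₂ removable₁ removable₂
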